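{- Let $(G,L)$ be a list-obstruction and let $X\subseteq V(G)$ be such that $|L(x)|=1$ for every $x\in X$. Let $L'$ be the list system obtained from $L$ by updating with respect to $X$ three times, and let $(G',L')$ be a minimal list-obstruction induced by $(G,L')$. Then there exists a minimal list-obstruction $(G'',L)$ induced by $(G,L)$ with $|V(G'')|\le 36|V(G')|$.
   Context: A list system $L$ of a finite simple graph $G$ assigns to each vertex a set $L(v)\subseteq\{1,2,3\}$; $(G,L)$ is a list-obstruction if there is no proper coloring $c$ with $c(v)\in L(v)$ for all $v$. A minimal list-obstruction induced by $(G,L)$ is a pair $(G',L|_{V(G')})$ with $G'$ an induced subgraph of $G$ which is not colorable from its lists while every proper induced subgraph of $G'$ is. Updating: let $X_0=X$, $L_0=L$. For $i\ge1$, $L_i$ is obtained from $L_{i-1}$ by removing from $L_{i-1}(v)$, for each $v\notin X_{i-1}$, every color $a$ such that $v$ has a neighbor $x\in X_{i-1}$ with $L_{i-1}(x)=\{a\}$ (lists of vertices in $X_{i-1}$ unchanged); and $X_i=X_{i-1}\cup\{v\notin X_{i-1}: |L_i(v)|\le1 \text{ and } |L_{i-1}(v)|>1\}$. Convention: if for some $i$ two adjacent vertices of $X_{i-1}$ have the same list, or $L_i(v)=\emptyset$ for some $v$, then set $L_i(v)=\emptyset$ for every $v\in V(G)\setminus X_i$. The list system obtained by updating with respect to $X$ three times is $L_3$. -}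

module Defs where

open import Data.Bool using (Bool; true; false; _∧_; _∨_; not; if_then_else_)
open import Data.Nat using (ℕ; zero; suc; _≤ᵇ_; _<ᵇ_; _≡ᵇ_)
open import Data.Fin using (Fin)
open import Data.Fin.Subset using (Subset; _∈_; _⊂_; ∣_∣; ⁅_⁆; ⊥; ⊤)
open import Data.Vec using (Vec; lookup; tabulate)
import Data.Vec.Properties as VecP
open import Data.List using (List; allFin)
open import Data.Bool.ListAction using (any)
open import Data.Product using (Σ; _×_; _,_)
open import Relation.Binary.PropositionalEquality using (_≡_; _≢_)
open import Relation.Nullary using (¬_; does)
import Data.Bool.Properties as BoolP

record Graph (n : ℕ) : Set where
  field
    adj   : Fin n → Fin n → Bool
    sym   : ∀ u v → adj u v ≡ adj v u
    irrefl : ∀ v → adj v v ≡ false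
open Graph public

ListSystem : ℕ → Set
ListSystem n = Fin n → Subset 3

-- The induced subgraph G[S] (S a vertex subset) is colourable from L.
Colorable : ∀ {n} → Graph n → ListSystem n → Subset n → Set
Colorable {n} G L S =
  Σ (Fin n → Fin 3) λ c →
    (∀ v → v ∈ S → c v ∈ L v) ×
    (∀ u v → u ∈ S → v ∈ S → adj G u v ≡ true → c u ≢ c v)

ListObstruction : ∀ {n} → Graph n → ListSystem n → Set
ListObstruction G L = ¬ Colorable G L ⊤

-- (G[S], L|S) is a minimal list-obstruction induced by (G, L).
MinimalObstruction : ∀ {n} → Graph n → ListSystem n → Subset n → Set
MinimalObstruction G L S =
  ¬ Colorable G L S × (∀ S′ → S′ ⊂ S → Colorable G L S′)

anyFin : ∀ {n} → (Fin n → Bool) → Bool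
anyFin {n} p = any p (allFin n)

eqSubset : ∀ {k} → Subset k → Subset k → Bool
eqSubset p q = does (VecP.≡-dec BoolP._≟_ p q)

-- One updating step with respect to X (X = X_{i-1}, L = L_{i-1});
-- returns (X_i, L_i), including the convention.
updateStep : ∀ {n} → Graph n → Subset n × ListSystem n → Subset n × ListSystem n
updateStep {n} G (X , L) = X′ , Lfin
  where
  inX : Fin n → Bool
  inX v = lookup X v

  forced : Fin n → Fin 3 → Bool
  forced v a = anyFin (λ x → adj G v x ∧ inX x ∧ eqSubset (L x) ⁅ a ⁆)

  Lraw : ListSystem n
  Lraw v = if inX v then L v
           else tabulate (λ a → lookup (L v) a ∧ not (forced v a))

  X′ : Subset n
  X′ = tabulate (λ v → inX v ∨ (not (inX v) ∧ (∣ Lraw v ∣ ≤ᵇ 1) ∧ (1 <ᵇ ∣ L v ∣)))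

  bad : Bool
  bad = anyFin (λ x → anyFin (λ y → adj G x y ∧ inX x ∧ inX y ∧ eqSubset (L x) (L y)))
        ∨ anyFin (λ v → ∣ Lraw v ∣ ≡ᵇ 0)

  Lfin : ListSystem n
  Lfin v = if bad ∧ not (lookup X′ v) then ⊥ else Lraw v

updateIter : ∀ {n} → ℕ → Graph n → Subset n × ListSystem n → Subset n × ListSystem n
updateIter zero    G p = p
updateIter (suc k) G p = updateStep G (updateIter k G p)

update3 : ∀ {n} → Graph n → Subset n → ListSystem n → ListSystem n
update3 G X L = Data.Product.proj₂ (updateIter 3 G (X , L))

-- A colour a leaves the list of v during updating only because v has a
-- neighbour x ∈ X whose list has become {a}. Unwinding this gives each
-- vertex v at level i a certificate C_i(v) ∋ v such that every L-colouring
-- of C_i(v) colours v from L_i(v): C_{i+1}(v) is v together with C_i(x) for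
-- one such neighbour x per removed colour. If x has a singleton list only two
-- colours were removed from it, so these certificates have at most 1, 3, 7, 15
-- vertices and arbitrary ones at most 1, 4, 10, 22. If no conflict occurs,
-- the certificates of the vertices of G′ form a set that is not L-colourable;
-- a conflict at step i (two adjacent vertices of X_i with the same list, or
-- an empty list) is witnessed by two certificates of level i or one of
-- level i + 1. Either way a non-L-colourable set of size at most 22|V(G′)|
-- results, and it contains a minimal list-obstruction.
module Submission where

open import Defs hiding (sym)
open import Data.Bool as Bool using (Bool; true; false; T; _∧_; _∨_; not; if_then_else_)
open import Data.Bool.Properties using (T-≡; T-∧; T-∨)
open import Data.Empty using (⊥-elim)
open import Data.Fin using (Fin; zero; suc)
open import Data.Fin.Properties using (any?; all?) renaming (_≟_ to _≟ᶠ_)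
open import Data.Fin.Subset using (Subset; _∈_; _∉_; _⊆_; ∣_∣; ⁅_⁆; ⊥; _∪_; ∁; Nonempty; inside; outside)
open import Data.Fin.Subset.Properties
  using (_∈?_; _⊂?_; anySubset?; nonempty?; ∣⊥∣≡0; ∣⁅x⁆∣≡1; ∣p∣≤n; ∣p∣≤∣x∷p∣; ∣∁p∣≡n∸∣p∣;
         x∈⁅x⁆; x∈⁅y⁆⇒x≡y; x∉p⇒x∈∁p; p⊆p∪q; q⊆p∪q; p⊆q⇒∣p∣≤∣q∣; p⊂q⇒∣p∣<∣q∣)
open import Data.List using (allFin)
open import Data.List.Relation.Unary.Any using (satisfied)
open import Data.List.Relation.Unary.Any.Properties using (any⁻)
open import Data.Maybe using (Maybe; maybe)
open import Data.Nat using (ℕ; zero; suc; _+_; _*_; _∸_; _≤_; _<_; _≤ᵇ_; _<ᵇ_; _≡ᵇ_; z≤n; s≤s; NonZero; >-nonZero)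
open import Data.Nat.Induction using (<-wellFounded)
open import Data.Nat.Properties
open import Data.Nat.Tactic.RingSolver using (solve-∀)
open import Data.Product using (Σ; ∃; ∃₂; _×_; _,_; proj₁; proj₂)
import Data.Product as Product
open import Data.Sum using (_⊎_; inj₁; inj₂)
open import Data.Unit using (tt) renaming (⊤ to Unit)
open import Data.Vec using ([]; _∷_; lookup; tabulate; here; there)
open import Data.Vec.Properties using ([]=⇒lookup; lookup⇒[]=; lookup∘tabulate)
import Data.Vec.Properties as Vec
open import Function using (_∘_; id)
open import Function.Bundles using (Equivalence)
open import Induction.WellFounded using (Acc; acc)
open import Relation.Binary.Construct.On as On using ()
open import Relation.Binary.PropositionalEquality
  using (_≡_; _≢_; refl; sym; trans; cong; cong-app; subst; module ≡-Reasoning)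
open import Relation.Nullary using (¬_; Dec; yes; no; ¬?; contradiction)
open import Relation.Nullary.Decidable using (_×-dec_; _→-dec_; decidable-stable; dec⇒maybe)
open import Relation.Unary using (Decidable)

open Equivalence using (to; from)

∣p∪q∣≤∣p∣+∣q∣ : ∀ {n} (p q : Subset n) → ∣ p ∪ q ∣ ≤ ∣ p ∣ + ∣ q ∣
∣p∪q∣≤∣p∣+∣q∣ []            []            = z≤n
∣p∪q∣≤∣p∣+∣q∣ (inside ∷ p)  (inside ∷ q)  = s≤s (≤-trans (∣p∪q∣≤∣p∣+∣q∣ p q) (≤-trans (n≤1+n _) (≤-reflexive (sym (+-suc _ _)))))
∣p∪q∣≤∣p∣+∣q∣ (inside ∷ p)  (outside ∷ q) = s≤s (∣p∪q∣≤∣p∣+∣q∣ p q)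
∣p∪q∣≤∣p∣+∣q∣ (outside ∷ p) (inside ∷ q)  = ≤-trans (s≤s (∣p∪q∣≤∣p∣+∣q∣ p q)) (≤-reflexive (sym (+-suc _ _)))
∣p∪q∣≤∣p∣+∣q∣ (outside ∷ p) (outside ∷ q) = ∣p∪q∣≤∣p∣+∣q∣ p q

∣p∣≡0⇒x∉p : ∀ {n} {p : Subset n} {x} → ∣ p ∣ ≡ 0 → x ∉ p
∣p∣≡0⇒x∉p {p = inside ∷ p}  ()
∣p∣≡0⇒x∉p {p = outside ∷ p} e (there x∈p) = ∣p∣≡0⇒x∉p e x∈p

∣p∣≤1⇒∈-unique : ∀ {n} {p : Subset n} {x y} → ∣ p ∣ ≤ 1 → x ∈ p → y ∈ p → x ≡ y
∣p∣≤1⇒∈-unique _           here       here       = refl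
∣p∣≤1⇒∈-unique (s≤s ∣p∣≤0) here       (there y∈p) = contradiction y∈p (∣p∣≡0⇒x∉p (n≤0⇒n≡0 ∣p∣≤0))
∣p∣≤1⇒∈-unique (s≤s ∣p∣≤0) (there x∈p) here      = contradiction x∈p (∣p∣≡0⇒x∉p (n≤0⇒n≡0 ∣p∣≤0))
∣p∣≤1⇒∈-unique {p = s ∷ p} ∣p∣≤1 (there x∈p) (there y∈p) =
  cong suc (∣p∣≤1⇒∈-unique (≤-trans (∣p∣≤∣x∷p∣ s p) ∣p∣≤1) x∈p y∈p)

x∈p⇒0<∣p∣ : ∀ {n} {p : Subset n} {x} → x ∈ p → 0 < ∣ p ∣
x∈p⇒0<∣p∣ {p = p} {x} x∈p = ≤-trans (≤-reflexive (sym (∣⁅x⁆∣≡1 x))) (p⊆q⇒∣p∣≤∣q∣ ⁅x⁆⊆p)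
  where
  ⁅x⁆⊆p : ⁅ x ⁆ ⊆ p
  ⁅x⁆⊆p y∈⁅x⁆ = subst (_∈ p) (sym (x∈⁅y⁆⇒x≡y x y∈⁅x⁆)) x∈p

⋃[_]_ : ∀ {m n} → Subset m → (Fin m → Subset n) → Subset n
⋃[ [] ]         f = ⊥
⋃[ inside ∷ S ]  f = f zero ∪ ⋃[ S ] (f ∘ suc)
⋃[ outside ∷ S ] f = ⋃[ S ] (f ∘ suc)

⊆-⋃ : ∀ {m n} {S : Subset m} {f : Fin m → Subset n} {v} → v ∈ S → f v ⊆ ⋃[ S ] f
⊆-⋃ {S = inside ∷ S}  here        = p⊆p∪q _
⊆-⋃ {S = inside ∷ S}  (there v∈S) = q⊆p∪q _ _ ∘ ⊆-⋃ v∈S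
⊆-⋃ {S = outside ∷ S} (there v∈S) = ⊆-⋃ v∈S

∣⋃∣≤ : ∀ {m n} (S : Subset m) {f : Fin m → Subset n} {k} →
       (∀ {v} → v ∈ S → ∣ f v ∣ ≤ k) → ∣ ⋃[ S ] f ∣ ≤ k * ∣ S ∣
∣⋃∣≤ {n = n} [] _ = ≤-trans (≤-reflexive (∣⊥∣≡0 n)) z≤n
∣⋃∣≤ (inside ∷ S) {f} {k} bound = begin
  ∣ f zero ∪ ⋃[ S ] (f ∘ suc) ∣       ≤⟨ ∣p∪q∣≤∣p∣+∣q∣ (f zero) _ ⟩
  ∣ f zero ∣ + ∣ ⋃[ S ] (f ∘ suc) ∣   ≤⟨ +-mono-≤ (bound here) (∣⋃∣≤ S (bound ∘ there)) ⟩
  k + k * ∣ S ∣                       ≡⟨ *-suc k ∣ S ∣ ⟨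
  k * suc ∣ S ∣                       ∎
  where open ≤-Reasoning
∣⋃∣≤ (outside ∷ S) bound = ∣⋃∣≤ S (bound ∘ there)

anyFin⁻ : ∀ {n} (p : Fin n → Bool) → T (anyFin p) → ∃ λ x → T (p x)
anyFin⁻ {n} p = satisfied ∘ any⁻ p (allFin n)

T-eqSubset⇒≡ : ∀ {k} {p q : Subset k} → T (eqSubset p q) → p ≡ q
T-eqSubset⇒≡ {p = p} {q} _ with Vec.≡-dec Bool._≟_ p q
... | yes p≡q = p≡q

T-lookup⇒∈ : ∀ {n} {p : Subset n} {x} → T (lookup p x) → x ∈ p
T-lookup⇒∈ {p = p} {x} t = lookup⇒[]= x p (to T-≡ t)

-- Pointwise-respecting predicates stand in for function extensionality.
∃-function? : ∀ {n k} {P : (Fin n → Fin k) → Set} →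
              (∀ {f g} → (∀ i → f i ≡ g i) → P f → P g) →
              (∀ f → Dec (P f)) → Dec (∃ P)
∃-function? {zero} resp P? with P? (λ ())
... | yes p = yes (_ , p)
... | no ¬p = no λ (f , pf) → ¬p (resp (λ ()) pf)
∃-function? {suc n} {k} {P} resp P?
  with any? (λ a → ∃-function? (λ f≗g → resp (cons-cong a f≗g)) (P? ∘ cons a))
  where
  cons : Fin k → (Fin n → Fin k) → Fin (suc n) → Fin k
  cons a f zero    = a
  cons a f (suc i) = f i
  cons-cong : ∀ a {f g} → (∀ i → f i ≡ g i) → ∀ i → cons a f i ≡ cons a g i
  cons-cong a f≗g zero    = refl
  cons-cong a f≗g (suc i) = f≗g i
... | yes (_ , _ , p) = yes (_ , p)
... | no ¬p = no λ (f , pf) → ¬p (f zero , f ∘ suc , resp (λ { zero → refl ; (suc i) → refl }) pf)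

colorable? : ∀ {n} (G : Graph n) (L : ListSystem n) (S : Subset n) → Dec (Colorable G L S)
colorable? G L S = ∃-function? resp λ c →
  all? (λ v → (v ∈? S) →-dec (c v ∈? L v)) ×-dec
  all? (λ u → all? λ v → (u ∈? S) →-dec ((v ∈? S) →-dec ((adj G u v Bool.≟ true) →-dec ¬? (c u ≟ᶠ c v))))
  where
  IsColoring : (Fin _ → Fin 3) → Set
  IsColoring c = (∀ v → v ∈ S → c v ∈ L v) × (∀ u v → u ∈ S → v ∈ S → adj G u v ≡ true → c u ≢ c v)
  resp : ∀ {c d} → (∀ v → c v ≡ d v) → IsColoring c → IsColoring d
  resp c≗d (valid , proper) =
    (λ v v∈S → subst (_∈ L v) (c≗d v) (valid v v∈S)) ,
    (λ u v u∈S v∈S uv du≡dv → proper u v u∈S v∈S uv (trans (c≗d u) (trans du≡dv (sym (c≗d v)))))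

¬Colorable⇒Nonempty : ∀ {n} (G : Graph n) (L : ListSystem n) {S} → ¬ Colorable G L S → Nonempty S
¬Colorable⇒Nonempty G L {S} ¬col with nonempty? S
... | yes ne = ne
... | no ¬ne = ⊥-elim (¬col ((λ _ → zero) , (λ v v∈S → ⊥-elim (¬ne (v , v∈S))) , (λ u _ u∈S → ⊥-elim (¬ne (u , u∈S)))))

minimalObstruction-within : ∀ {n} (G : Graph n) (L : ListSystem n) {T} → ¬ Colorable G L T →
                            Σ (Subset n) λ S → MinimalObstruction G L S × ∣ S ∣ ≤ ∣ T ∣
minimalObstruction-within G L {T} = go (On.wellFounded ∣_∣ <-wellFounded T)
  where
  go : ∀ {T} → Acc (λ S T → ∣ S ∣ < ∣ T ∣) T → ¬ Colorable G L T →
       Σ (Subset _) λ S → MinimalObstruction G L S × ∣ S ∣ ≤ ∣ T ∣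
  go {T} (acc rec) ¬col with anySubset? (λ S → (S ⊂? T) ×-dec ¬? (colorable? G L S))
  ... | yes (S , S⊂T , ¬colS) =
    let R , minR , ∣R∣≤∣S∣ = go (rec (p⊂q⇒∣p∣<∣q∣ S⊂T)) ¬colS
    in R , minR , ≤-trans ∣R∣≤∣S∣ (<⇒≤ (p⊂q⇒∣p∣<∣q∣ S⊂T))
  ... | no none = T , (¬col , λ S S⊂T → decidable-stable (colorable? G L S) (λ ¬colS → none (S , S⊂T , ¬colS))) , ≤-refl

-- The where-clauses of updateStep, spelled out so that they can be named.
module Updating {n} (G : Graph n) (X : Subset n) (L : ListSystem n) where

  forced : Fin n → Fin 3 → Bool
  forced v a = anyFin (λ x → adj G v x ∧ lookup X x ∧ eqSubset (L x) ⁅ a ⁆)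

  pruned : ListSystem n
  pruned v = if lookup X v then L v else tabulate (λ a → lookup (L v) a ∧ not (forced v a))

  newlySingleton : Fin n → Bool
  newlySingleton v = not (lookup X v) ∧ (∣ pruned v ∣ ≤ᵇ 1) ∧ (1 <ᵇ ∣ L v ∣)

  X′ : Subset n
  X′ = tabulate (λ v → lookup X v ∨ newlySingleton v)

  conflict : Bool
  conflict = anyFin (λ x → anyFin (λ y → adj G x y ∧ lookup X x ∧ lookup X y ∧ eqSubset (L x) (L y)))
             ∨ anyFin (λ v → ∣ pruned v ∣ ≡ᵇ 0)

  updateStep-lists : conflict ≡ false → proj₂ (updateStep G (X , L)) ≡ pruned
  updateStep-lists e rewrite e = refl

  pruned-on-X : ∀ {v} → v ∈ X → pruned v ≡ L v
  pruned-on-X {v} v∈X rewrite []=⇒lookup v∈X = refl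

  X⊆X′ : X ⊆ X′
  X⊆X′ {v} v∈X = lookup⇒[]= v X′ (trans (lookup∘tabulate _ v) (cong (_∨ newlySingleton v) ([]=⇒lookup v∈X)))

  X′-new : ∀ {v} → v ∈ X′ → v ∈ X ⊎ ∣ pruned v ∣ ≤ 1
  X′-new {v} v∈X′ with lookup X v in v∈?X | trans (sym (lookup∘tabulate _ v)) ([]=⇒lookup v∈X′)
  ... | true  | _   = inj₁ (lookup⇒[]= v X v∈?X)
  ... | false | new = inj₂ (≤ᵇ⇒≤ _ 1 (proj₁ (to T-∧ (from T-≡ new))))

  forced⇒neighbour : ∀ {v a} → T (forced v a) → ∃ λ x → adj G v x ≡ true × x ∈ X × L x ≡ ⁅ a ⁆
  forced⇒neighbour {v} {a} t =
    let x , vx∧x∈X∧Lx = anyFin⁻ _ t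
        vx , x∈X∧Lx = to T-∧ vx∧x∈X∧Lx
        x∈X , Lx = to T-∧ x∈X∧Lx
    in x , to T-≡ vx , T-lookup⇒∈ x∈X , T-eqSubset⇒≡ Lx

  dropped⇒neighbour : ∀ {v a} → a ∈ L v → a ∉ pruned v → ∃ λ x → adj G v x ≡ true × x ∈ X × L x ≡ ⁅ a ⁆
  dropped⇒neighbour {v} {a} a∈L a∉pruned with lookup X v in v∈?X
  ... | true  = contradiction a∈L a∉pruned
  ... | false with forced v a in isForced
  ...   | true  = forced⇒neighbour (from T-≡ isForced)
  ...   | false = contradiction (lookup⇒[]= a _ kept) a∉pruned
    where
    kept : lookup (tabulate (λ b → lookup (L v) b ∧ not (forced v b))) a ≡ true
    kept rewrite lookup∘tabulate (λ b → lookup (L v) b ∧ not (forced v b)) a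
               | []=⇒lookup a∈L | isForced = refl

  conflict⇒ : T conflict →
              (∃₂ λ x y → adj G x y ≡ true × x ∈ X × y ∈ X × L x ≡ L y) ⊎ (∃ λ v → ∣ pruned v ∣ ≡ 0)
  conflict⇒ t with to T-∨ t
  ... | inj₁ adjacent =
    let x , t₁ = anyFin⁻ _ adjacent
        y , t₂ = anyFin⁻ _ t₁
        xy , t₃ = to T-∧ t₂
        x∈X , t₄ = to T-∧ t₃
        y∈X , Lx≡Ly = to T-∧ t₄
    in inj₁ (x , y , to T-≡ xy , T-lookup⇒∈ x∈X , T-lookup⇒∈ y∈X , T-eqSubset⇒≡ Lx≡Ly)
  ... | inj₂ empty = let v , t₁ = anyFin⁻ _ empty in inj₂ (v , ≡ᵇ⇒≡ _ 0 t₁)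

-- Certificates

singletonBound : ℕ → ℕ
singletonBound zero    = 1
singletonBound (suc i) = suc (singletonBound i * 2)

certBound : ℕ → ℕ
certBound zero    = 1
certBound (suc i) = suc (singletonBound i * 3)

singletonBound-mono : ∀ {j i} → j ≤ i → singletonBound j ≤ singletonBound i
singletonBound-mono {i = zero}  z≤n       = ≤-refl
singletonBound-mono {i = suc i} z≤n       = s≤s z≤n
singletonBound-mono             (s≤s j≤i) = s≤s (*-monoˡ-≤ 2 (singletonBound-mono j≤i))

certBound-suc-mono : ∀ {j i} → j < i → certBound (suc j) ≤ certBound i
certBound-suc-mono (s≤s j≤i) = s≤s (*-monoˡ-≤ 3 (singletonBound-mono j≤i))

certBound-double : ∀ j → certBound j + certBound j ≤ certBound (suc j)
certBound-double zero    = s≤s (s≤s z≤n)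
certBound-double (suc j) = ≤-trans (m≤m+n _ 2) (≤-reflexive (identity (singletonBound j)))
  where
  identity : ∀ s → suc (s * 3) + suc (s * 3) + 2 ≡ suc (suc (s * 2) * 3)
  identity = solve-∀

module Levels {n} (G : Graph n) (L₀ : ListSystem n) (X₀ : Subset n)
              (singletons : ∀ x → x ∈ X₀ → ∣ L₀ x ∣ ≡ 1) where

  X[_] : ℕ → Subset n
  X[ i ] = proj₁ (updateIter i G (X₀ , L₀))

  L[_] : ℕ → ListSystem n
  L[ i ] = proj₂ (updateIter i G (X₀ , L₀))

  module Step (i : ℕ) = Updating G X[ i ] L[ i ]
  open Step using (pruned; conflict)

  Unconflicted : ℕ → Set
  Unconflicted zero    = Unit
  Unconflicted (suc i) = conflict i ≡ false × Unconflicted i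

  unconflicted-or-conflict : ∀ i → Unconflicted i ⊎ ∃ λ j → j < i × Unconflicted j × T (conflict j)
  unconflicted-or-conflict zero = inj₁ tt
  unconflicted-or-conflict (suc i) with unconflicted-or-conflict i
  ... | inj₂ (j , j<i , u , c) = inj₂ (j , m≤n⇒m≤1+n j<i , u , c)
  ... | inj₁ u with conflict i in c
  ...   | true  = inj₂ (i , ≤-refl , u , from T-≡ c)
  ...   | false = inj₁ (refl , u)

  L-suc : ∀ {i} → Unconflicted (suc i) → L[ suc i ] ≡ pruned i
  L-suc {i} (c , _) = Step.updateStep-lists i c

  ∣L∣≤1-on-X : ∀ i {x} → Unconflicted i → x ∈ X[ i ] → ∣ L[ i ] x ∣ ≤ 1
  ∣L∣≤1-on-X zero    _ x∈X = ≤-reflexive (singletons _ x∈X)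
  ∣L∣≤1-on-X (suc i) {x} u x∈X =
    subst (λ l → ∣ l ∣ ≤ 1) (sym (cong-app (L-suc u) x)) ∣pruned∣≤1
    where
    ∣pruned∣≤1 : ∣ pruned i x ∣ ≤ 1
    ∣pruned∣≤1 with Step.X′-new i x∈X
    ... | inj₁ x∈Xᵢ = subst (λ l → ∣ l ∣ ≤ 1) (sym (Step.pruned-on-X i x∈Xᵢ)) (∣L∣≤1-on-X i (proj₂ u) x∈Xᵢ)
    ... | inj₂ new   = new

  ForcedBy : ℕ → Fin n → Fin 3 → Fin n → Set
  ForcedBy i v a x = adj G v x ≡ true × x ∈ X[ i ] × L[ i ] x ≡ ⁅ a ⁆

  forcedBy? : ∀ i v a → Decidable (ForcedBy i v a)
  forcedBy? i v a x = (adj G v x Bool.≟ true) ×-dec (x ∈? X[ i ]) ×-dec Vec.≡-dec Bool._≟_ (L[ i ] x) ⁅ a ⁆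

  ForcedBy-suc : ∀ {i v a x} → Unconflicted (suc i) → ForcedBy i v a x → ForcedBy (suc i) v a x
  ForcedBy-suc {i} {x = x} u (vx , x∈X , Lx) =
    vx , Step.X⊆X′ i x∈X , trans (cong-app (L-suc u) x) (trans (Step.pruned-on-X i x∈X) Lx)

  dropped⇒ForcedBy : ∀ i {v a} → Unconflicted i → a ∈ L₀ v → a ∉ pruned i v → ∃ (ForcedBy i v a)
  dropped⇒ForcedBy i {v} {a} u a∈L₀ a∉pruned with a ∈? L[ i ] v
  ... | yes a∈L = Step.dropped⇒neighbour i a∈L a∉pruned
  dropped⇒ForcedBy zero    u a∈L₀ a∉pruned | no a∉L₀ = contradiction a∈L₀ a∉L₀
  dropped⇒ForcedBy (suc i) {v} {a} u a∈L₀ a∉pruned | no a∉L =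
    Product.map₂ (ForcedBy-suc u)
      (dropped⇒ForcedBy i (proj₂ u) a∈L₀ (a∉L ∘ subst (a ∈_) (sym (cong-app (L-suc u) v))))

  forcingNeighbour : ∀ i v a → Maybe (∃ (ForcedBy i v a))
  forcingNeighbour i v a = dec⇒maybe (any? (forcedBy? i v a))

  mutual
    certificate : ℕ → Fin n → Subset n
    certificate zero    v = ⁅ v ⁆
    certificate (suc i) v = ⁅ v ⁆ ∪ ⋃[ ∁ (pruned i v) ] forcingCertificate i v

    forcingCertificate : ℕ → Fin n → Fin 3 → Subset n
    forcingCertificate i v a = maybe (certificate i ∘ proj₁) ⊥ (forcingNeighbour i v a)

  v∈certificate : ∀ i v → v ∈ certificate i v
  v∈certificate zero    v = x∈⁅x⁆ v
  v∈certificate (suc i) v = p⊆p∪q _ (x∈⁅x⁆ v)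

  forcingCertificate-of : ∀ {i v a x} → ForcedBy i v a x →
                          ∃ λ y → ForcedBy i v a y × forcingCertificate i v a ≡ certificate i y
  forcingCertificate-of {i} {v} {a} {x} fx with any? (forcedBy? i v a)
  ... | yes (y , fy) = y , fy , refl
  ... | no none      = contradiction (x , fx) none

  forcingCertificate⊆ : ∀ {i v a} → a ∉ pruned i v → forcingCertificate i v a ⊆ certificate (suc i) v
  forcingCertificate⊆ a∉pruned = q⊆p∪q _ _ ∘ ⊆-⋃ (x∉p⇒x∈∁p a∉pruned)

  module Forcing {T : Subset n} (col : Colorable G L₀ T) where
    private
      c = proj₁ col
      valid = proj₁ (proj₂ col)
      proper = proj₂ (proj₂ col)

    mutual
      certificate-forces : ∀ i {v} → Unconflicted i → certificate i v ⊆ T → c v ∈ L[ i ] v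
      certificate-forces zero    {v} _ cert⊆T = valid v (cert⊆T (x∈⁅x⁆ v))
      certificate-forces (suc i) {v} u cert⊆T =
        subst (c v ∈_) (sym (cong-app (L-suc u) v)) (certificate-forces-pruned i (proj₂ u) cert⊆T)

      certificate-forces-pruned : ∀ i {v} → Unconflicted i → certificate (suc i) v ⊆ T → c v ∈ pruned i v
      certificate-forces-pruned i {v} u cert⊆T =
        decidable-stable (c v ∈? pruned i v) (colour-not-removed i u cert⊆T)

      colour-not-removed : ∀ i {v} → Unconflicted i → certificate (suc i) v ⊆ T → ¬ c v ∉ pruned i v
      colour-not-removed i {v} u cert⊆T cv∉pruned =
        let x , fx = dropped⇒ForcedBy i u (valid v v∈T) cv∉pruned
            y , (vy , _ , Ly) , forcing≡ = forcingCertificate-of {i} {v} fx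
            certy⊆T : certificate i y ⊆ T
            certy⊆T w∈ = cert⊆T (forcingCertificate⊆ {i} {v} cv∉pruned (subst (_ ∈_) (sym forcing≡) w∈))
            cy∈⁅cv⁆ = subst (c y ∈_) Ly (certificate-forces i u certy⊆T)
        in proper v y v∈T (certy⊆T (v∈certificate i y)) vy (sym (x∈⁅y⁆⇒x≡y (c v) cy∈⁅cv⁆))
        where
        v∈T = cert⊆T (v∈certificate (suc i) v)

  certificates-obstruct : ∀ i {S} → Unconflicted i → ¬ Colorable G L[ i ] S →
                          ¬ Colorable G L₀ (⋃[ S ] certificate i)
  certificates-obstruct i u ¬col col@(c , _ , proper) = ¬col
    (c , (λ v v∈S → Forcing.certificate-forces col i u (⊆-⋃ v∈S)) ,
     λ x y x∈S y∈S → proper x y (⊆-⋃ x∈S (v∈certificate i x)) (⊆-⋃ y∈S (v∈certificate i y)))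

  mutual
    ∣certificate-suc∣≤ : ∀ i {v} → Unconflicted i →
                         ∣ certificate (suc i) v ∣ ≤ suc (singletonBound i * ∣ ∁ (pruned i v) ∣)
    ∣certificate-suc∣≤ i {v} u =
      ≤-trans (∣p∪q∣≤∣p∣+∣q∣ ⁅ v ⁆ _)
              (+-mono-≤ (≤-reflexive (∣⁅x⁆∣≡1 v)) (∣⋃∣≤ (∁ (pruned i v)) λ _ → ∣forcingCertificate∣≤ i u))

    ∣forcingCertificate∣≤ : ∀ i {v a} → Unconflicted i → ∣ forcingCertificate i v a ∣ ≤ singletonBound i
    ∣forcingCertificate∣≤ i {v} {a} u with any? (forcedBy? i v a)
    ... | yes (y , _ , _ , Ly) = ∣certificate∣≤singletonBound i u Ly
    ... | no _                 = ≤-trans (≤-reflexive (∣⊥∣≡0 n)) z≤n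

    ∣certificate∣≤singletonBound : ∀ i {x b} → Unconflicted i → L[ i ] x ≡ ⁅ b ⁆ →
                                   ∣ certificate i x ∣ ≤ singletonBound i
    ∣certificate∣≤singletonBound zero    {x}     _ _  = ≤-reflexive (∣⁅x⁆∣≡1 x)
    ∣certificate∣≤singletonBound (suc i) {x} {b} u Lx =
      ≤-trans (∣certificate-suc∣≤ i (proj₂ u)) (s≤s (≤-reflexive (cong (singletonBound i *_) two-removed)))
      where
      two-removed : ∣ ∁ (pruned i x) ∣ ≡ 2
      two-removed = begin
        ∣ ∁ (pruned i x) ∣         ≡⟨ cong (∣_∣ ∘ ∁) (trans (sym (cong-app (L-suc u) x)) Lx) ⟩
        ∣ ∁ ⁅ b ⁆ ∣                ≡⟨ ∣∁p∣≡n∸∣p∣ ⁅ b ⁆ ⟩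
        3 ∸ ∣ ⁅ b ⁆ ∣              ≡⟨ cong (3 ∸_) (∣⁅x⁆∣≡1 b) ⟩
        2                          ∎
        where open ≡-Reasoning

  ∣certificate-suc∣≤certBound : ∀ i {v} → Unconflicted i → ∣ certificate (suc i) v ∣ ≤ certBound (suc i)
  ∣certificate-suc∣≤certBound i {v} u =
    ≤-trans (∣certificate-suc∣≤ i u) (s≤s (*-monoʳ-≤ (singletonBound i) (∣p∣≤n (∁ (pruned i v)))))

  ∣certificate∣≤certBound : ∀ i {v} → Unconflicted i → ∣ certificate i v ∣ ≤ certBound i
  ∣certificate∣≤certBound zero    {v} _ = ≤-reflexive (∣⁅x⁆∣≡1 v)
  ∣certificate∣≤certBound (suc i) {v} u = ∣certificate-suc∣≤certBound i {v} (proj₂ u)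

  SmallObstruction : ℕ → Set
  SmallObstruction k = Σ (Subset n) λ T → ¬ Colorable G L₀ T × ∣ T ∣ ≤ k

  conflict⇒SmallObstruction : ∀ i → Unconflicted i → T (conflict i) → SmallObstruction (certBound (suc i))
  conflict⇒SmallObstruction i u c with Step.conflict⇒ i c
  ... | inj₁ (x , y , xy , x∈X , y∈X , Lx≡Ly) =
    certificate i x ∪ certificate i y , pair-obstructs ,
    ≤-trans (∣p∪q∣≤∣p∣+∣q∣ (certificate i x) (certificate i y))
            (≤-trans (+-mono-≤ (∣certificate∣≤certBound i {x} u) (∣certificate∣≤certBound i {y} u)) (certBound-double i))
    where
    pair-obstructs : ¬ Colorable G L₀ (certificate i x ∪ certificate i y)
    pair-obstructs col@(c , _ , proper) =
      proper x y (p⊆p∪q _ (v∈certificate i x)) (q⊆p∪q _ _ (v∈certificate i y)) xy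
        (∣p∣≤1⇒∈-unique (∣L∣≤1-on-X i u x∈X)
          (Forcing.certificate-forces col i u (p⊆p∪q _))
          (subst (c y ∈_) (sym Lx≡Ly) (Forcing.certificate-forces col i u (q⊆p∪q _ _))))
  ... | inj₂ (v , ∣pruned∣≡0) =
    certificate (suc i) v ,
    (λ col → ∣p∣≡0⇒x∉p ∣pruned∣≡0 (Forcing.certificate-forces-pruned col i u id)) ,
    ∣certificate-suc∣≤certBound i {v} u

  small-obstruction : ∀ i {S} → ¬ Colorable G L[ i ] S → SmallObstruction (certBound i * ∣ S ∣)
  small-obstruction i {S} ¬col with unconflicted-or-conflict i
  ... | inj₁ u = ⋃[ S ] certificate i , certificates-obstruct i u ¬col ,
                 ∣⋃∣≤ S (λ _ → ∣certificate∣≤certBound i u)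
  ... | inj₂ (j , j<i , u , c) =
    let T , ¬colT , ∣T∣≤ = conflict⇒SmallObstruction j u c
        _ , v∈S = ¬Colorable⇒Nonempty G L[ i ] ¬col
        instance _ : NonZero ∣ S ∣
                 _ = >-nonZero (x∈p⇒0<∣p∣ v∈S)
    in T , ¬colT , ≤-trans ∣T∣≤ (≤-trans (certBound-suc-mono j<i) (m≤m*n (certBound i) ∣ S ∣))

lemma5 : (n : ℕ) (G : Graph n) (L : ListSystem n) (X : Subset n) →
    ListObstruction G L →
    (∀ x → x ∈ X → ∣ L x ∣ ≡ 1) →
    (S′ : Subset n) → MinimalObstruction G (update3 G X L) S′ →
    Σ (Subset n) λ S″ → MinimalObstruction G L S″ × ∣ S″ ∣ ≤ 36 * ∣ S′ ∣
lemma5 n G L X _ singletons S′ (¬col , _) =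
  let T , ¬colT , ∣T∣≤ = Levels.small-obstruction G L X singletons 3 ¬col
      S″ , minS″ , ∣S″∣≤∣T∣ = minimalObstruction-within G L ¬colT
  in S″ , minS″ , ≤-trans ∣S″∣≤∣T∣ (≤-trans ∣T∣≤ (*-monoˡ-≤ ∣ S′ ∣ (m≤m+n 22 14)))
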